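{- Let $G$ be a finite simple graph and let $n\ge 1$ be an integer. Then $\kappa(\mathcal{D}_n[G])=n\,\kappa(G)$, where $\kappa$ denotes vertex-connectivity.
   Context: For an integer $n\ge1$, the total graph $T_n$ is the graph obtained from the complete graph $K_n$ by adding a loop at every vertex. The Kronecker product $G\times H$ has vertex set $V(G)\times V(H)$, with $(u_1,v_1)$ adjacent to $(u_2,v_2)$ if and only if $u_1$ is adjacent to $u_2$ in $G$ and $v_1$ is adjacent to $v_2$ in $H$. Define $\mathcal{D}_n[G]=G\times T_n$; thus $(u,i)$ is adjacent to $(v,j)$ if and only if $uv\in E(G)$. -}

module Defs where

open import Data.Nat using (ℕ; _≤_; _*_)
open import Data.Bool using (Bool; true; false)
open import Data.Fin using (Fin; quotient)
open import Data.Fin.Subset using (Subset; _∉_; ∣_∣)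
open import Data.Product using (Σ; _×_; ∃-syntax)
open import Data.Sum using (_⊎_)
open import Relation.Nullary using (¬_)
open import Relation.Binary.PropositionalEquality using (_≡_)

record Graph (m : ℕ) : Set where
  field
    adj    : Fin m → Fin m → Bool
    sym    : ∀ u v → adj u v ≡ adj v u
    irrefl : ∀ u → adj u u ≡ false
open Graph public

data Reach {m : ℕ} (G : Graph m) (S : Subset m) : Fin m → Fin m → Set where
  here  : ∀ {u} → u ∉ S → Reach G S u u
  there : ∀ {u w v} → u ∉ S → adj G u w ≡ true → Reach G S w v → Reach G S u v

IsCut : {m : ℕ} → Graph m → Subset m → Set
IsCut {m} G S =
  (∀ u v → u ∉ S → v ∉ S → u ≡ v)
  ⊎ (∃[ u ] ∃[ v ] (u ∉ S × v ∉ S × ¬ Reach G S u v))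

IsVertexConnectivity : {m : ℕ} → Graph m → ℕ → Set
IsVertexConnectivity {m} G k =
  (∃[ S ] (IsCut G S × ∣ S ∣ ≡ k)) × (∀ S → IsCut G S → k ≤ ∣ S ∣)

-- D_n[G] = G × T_n. Vertex (u , i) ∈ Fin m × Fin n is encoded as
-- combine u i : Fin (m * n); quotient n recovers u.
-- (u,i) ~ (v,j) iff uv ∈ E(G).
D : {m : ℕ} (n : ℕ) → Graph m → Graph (m * n)
D {m} n G = record
  { adj    = λ x y → adj G (quotient n x) (quotient n y)
  ; sym    = λ x y → sym G (quotient n x) (quotient n y)
  ; irrefl = λ x → irrefl G (quotient n x)
  }

-- A cut S of G lifts to the cut S × Fin n of D_n[G], of size n|S|, since walks in
-- D_n[G] project to walks in G. Conversely, for a cut T of D_n[G] let S be the set of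
-- vertices whose whole fibre lies in T, so that n|S| ≤ |T|. Every vertex outside S
-- has a copy outside T, hence every walk of G - S with at least one edge lifts to
-- D_n[G] - T between any prescribed copies of its ends; this makes S a cut of G.
-- Trivial walks do not lift, which is why two copies of one vertex u need a separate
-- argument: they are joined through any neighbour of u outside S, and otherwise u is
-- isolated in G - S.
module Submission where

open import Defs hiding (sym)
open import Data.Nat using (ℕ; suc; _≤_; _*_; _+_)
open import Data.Nat.Properties using (*-zeroʳ; *-suc; *-monoʳ-≤; module ≤-Reasoning)
open import Data.Bool using (true; false)
open import Data.Fin using (Fin; quotient; remainder; combine)
import Data.Fin as Fin
open import Data.Fin.Properties using (remQuot-combine; combine-remQuot; any?; all?; ¬∀⟶∃¬; _≟_)
open import Data.Fin.Subset using (Subset; _∈_; _∉_; _⊆_; ∣_∣; inside; outside)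
open import Data.Fin.Subset.Properties using (_∈?_; ∣⊤∣≡n; ∣⊥∣≡0; p⊆q⇒∣p∣≤∣q∣)
open import Data.Vec using ([]; _∷_; _++_; concat; map; replicate; lookup; tabulate)
open import Data.Vec.Properties using (lookup-concat; lookup-map; lookup-replicate; lookup∘tabulate; []=⇒lookup; lookup⇒[]=)
open import Data.Product using (∃-syntax; _×_; _,_; proj₁)
open import Data.Sum using (inj₁; inj₂)
open import Data.Empty using (⊥)
open import Relation.Nullary using (yes; no; does; ¬?; contradiction)
open import Relation.Nullary.Decidable using (dec-true; dec-false; decidable-stable; _×-dec_)
open import Function using (_∘_)
open import Relation.Binary.PropositionalEquality using (_≡_; _≢_; refl; sym; trans; cong; subst; subst₂; module ≡-Reasoning)

∣p++q∣≡∣p∣+∣q∣ : ∀ {a b} (p : Subset a) (q : Subset b) → ∣ p ++ q ∣ ≡ ∣ p ∣ + ∣ q ∣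
∣p++q∣≡∣p∣+∣q∣ []            q = refl
∣p++q∣≡∣p∣+∣q∣ (inside  ∷ p) q = cong suc (∣p++q∣≡∣p∣+∣q∣ p q)
∣p++q∣≡∣p∣+∣q∣ (outside ∷ p) q = ∣p++q∣≡∣p∣+∣q∣ p q

preimage : ∀ {m} n → Subset m → Subset (m * n)
preimage n S = concat (map (replicate n) S)

∣preimage∣≡n*∣p∣ : ∀ {m} n (S : Subset m) → ∣ preimage n S ∣ ≡ n * ∣ S ∣
∣preimage∣≡n*∣p∣ n [] = sym (*-zeroʳ n)
∣preimage∣≡n*∣p∣ n (b ∷ S) = begin
  ∣ replicate n b ++ preimage n S ∣    ≡⟨ ∣p++q∣≡∣p∣+∣q∣ (replicate n b) (preimage n S) ⟩
  ∣ replicate n b ∣ + ∣ preimage n S ∣ ≡⟨ cong (∣ replicate n b ∣ +_) (∣preimage∣≡n*∣p∣ n S) ⟩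
  ∣ replicate n b ∣ + n * ∣ S ∣        ≡⟨ ∣replicate∣+n*∣S∣ b ⟩
  n * ∣ b ∷ S ∣                        ∎
  where
  open ≡-Reasoning
  ∣replicate∣+n*∣S∣ : ∀ b → ∣ replicate n b ∣ + n * ∣ S ∣ ≡ n * ∣ b ∷ S ∣
  ∣replicate∣+n*∣S∣ inside  = trans (cong (_+ n * ∣ S ∣) (∣⊤∣≡n n)) (sym (*-suc n ∣ S ∣))
  ∣replicate∣+n*∣S∣ outside = cong (_+ n * ∣ S ∣) (∣⊥∣≡0 n)

Isolated : ∀ {m} → Graph m → Subset m → Fin m → Set
Isolated G S u = ∀ {w} → adj G u w ≡ true → w ∉ S → ⊥

module _ {m : ℕ} {G : Graph m} {S : Subset m} where

  Reach-source∉ : ∀ {u v} → Reach G S u v → u ∉ S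
  Reach-source∉ (here u∉)      = u∉
  Reach-source∉ (there u∉ _ _) = u∉

  Reach-≢⇒edge : ∀ {u v} → u ≢ v → Reach G S u v → ∃[ w ] (adj G u w ≡ true × Reach G S w v)
  Reach-≢⇒edge u≢u (here _)              = contradiction refl u≢u
  Reach-≢⇒edge _   (there {w = w} _ a r) = w , a , r

  Reach-isolated : ∀ {u v} → Isolated G S u → Reach G S u v → u ≡ v
  Reach-isolated isolated (here _)      = refl
  Reach-isolated isolated (there _ a r) = contradiction (Reach-source∉ r) (isolated a)

  isolated⇒IsCut : ∀ {u} → u ∉ S → Isolated G S u → IsCut G S
  isolated⇒IsCut {u} u∉ isolated with any? (λ w → ¬? (w ∈? S) ×-dec ¬? (w ≟ u))
  ... | yes (w , w∉ , w≢u) = inj₂ (u , w , u∉ , w∉ , λ r → w≢u (sym (Reach-isolated isolated r)))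
  ... | no ∄other = inj₁ λ v w v∉ w∉ → trans (≡u v v∉) (sym (≡u w w∉))
    where
    ≡u : ∀ v → v ∉ S → v ≡ u
    ≡u v v∉ with v ≟ u
    ... | yes v≡u = v≡u
    ... | no  v≢u = contradiction (v , v∉ , v≢u) ∄other

module _ {m : ℕ} (n : ℕ) where

  π : Fin (m * n) → Fin m
  π = quotient n

  π-combine : ∀ u j → π (combine u j) ≡ u
  π-combine u j = cong proj₁ (remQuot-combine u j)

  lookup-preimage : ∀ S x → lookup (preimage n S) x ≡ lookup S (π x)
  lookup-preimage S x = begin
    lookup (preimage n S) x                       ≡⟨ cong (lookup (preimage n S)) (sym (combine-remQuot {m} n x)) ⟩
    lookup (preimage n S) (combine (π x) r)       ≡⟨ lookup-concat (map (replicate n) S) (π x) r ⟩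
    lookup (lookup (map (replicate n) S) (π x)) r ≡⟨ cong (λ v → lookup v r) (lookup-map (π x) (replicate n) S) ⟩
    lookup (replicate n (lookup S (π x))) r       ≡⟨ lookup-replicate r (lookup S (π x)) ⟩
    lookup S (π x)                                ∎
    where
    open ≡-Reasoning
    r : Fin n
    r = remainder {m} n x

  ∈preimage⁻ : ∀ {S x} → x ∈ preimage n S → π x ∈ S
  ∈preimage⁻ {S} {x} x∈ = lookup⇒[]= (π x) S (trans (sym (lookup-preimage S x)) ([]=⇒lookup x∈))

  ∈preimage⁺ : ∀ {S x} → π x ∈ S → x ∈ preimage n S
  ∈preimage⁺ {S} {x} πx∈ = lookup⇒[]= x (preimage n S) (trans (lookup-preimage S x) ([]=⇒lookup πx∈))
  ∉preimage⁻ : ∀ {S x} → x ∉ preimage n S → π x ∉ S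
  ∉preimage⁻ x∉ πx∈ = x∉ (∈preimage⁺ πx∈)

  ∉⇒combine∉preimage : ∀ {S u} j → u ∉ S → combine u j ∉ preimage n S
  ∉⇒combine∉preimage {S} {u} j u∉ c∈ = u∉ (subst (_∈ S) (π-combine u j) (∈preimage⁻ c∈))

  fullFibres : Subset (m * n) → Subset m
  fullFibres T = tabulate λ u → does (all? λ j → combine u j ∈? T)

  ∈fullFibres⁺ : ∀ {T u} → (∀ j → combine u j ∈ T) → u ∈ fullFibres T
  ∈fullFibres⁺ {T} {u} fibre⊆T = lookup⇒[]= u (fullFibres T)
    (trans (lookup∘tabulate _ u) (dec-true (all? λ j → combine u j ∈? T) fibre⊆T))

  ∈fullFibres⁻ : ∀ {T u} → u ∈ fullFibres T → ∀ j → combine u j ∈ T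
  ∈fullFibres⁻ {T} {u} u∈ = decidable-stable (all? λ j → combine u j ∈? T) λ fibre⊈T →
    outside≢inside (trans (sym (dec-false (all? λ j → combine u j ∈? T) fibre⊈T))
                          (trans (sym (lookup∘tabulate _ u)) ([]=⇒lookup u∈)))
    where
    outside≢inside : outside ≢ inside
    outside≢inside ()

  preimage-fullFibres⊆ : ∀ T → preimage n (fullFibres T) ⊆ T
  preimage-fullFibres⊆ T {x} x∈ =
    subst (_∈ T) (combine-remQuot {m} n x) (∈fullFibres⁻ (∈preimage⁻ x∈) (remainder {m} n x))

  ∉fullFibres⇒copy∉ : ∀ {T u} → u ∉ fullFibres T → ∃[ j ] combine u j ∉ T
  ∉fullFibres⇒copy∉ {T} {u} u∉ = ¬∀⟶∃¬ n _ (λ j → combine u j ∈? T) (u∉ ∘ ∈fullFibres⁺)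

  ∉⇒π∉fullFibres : ∀ {T x} → x ∉ T → π x ∉ fullFibres T
  ∉⇒π∉fullFibres {T} x∉ πx∈ = x∉ (preimage-fullFibres⊆ T (∈preimage⁺ πx∈))

  module _ (G : Graph m) where

    Reach-π : ∀ {S T} → (∀ {x} → x ∉ T → π x ∉ S) →
              ∀ {x y} → Reach (D n G) T x y → Reach G S (π x) (π y)
    Reach-π π∉ (here x∉)      = here (π∉ x∉)
    Reach-π π∉ (there x∉ a r) = there (π∉ x∉) a (Reach-π π∉ r)

    Reach-lift : ∀ {T x y w} → adj G (π x) w ≡ true → Reach G (fullFibres T) w (π y) →
                 x ∉ T → y ∉ T → Reach (D n G) T x y
    Reach-lift a (here _) x∉ y∉ = there x∉ a (here y∉)
    Reach-lift {x = x} {w = w} a (there {w = w′} w∉ a′ r) x∉ y∉ with ∉fullFibres⇒copy∉ w∉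
    ... | j , z∉ = there x∉ (subst (λ v → adj G (π x) v ≡ true) (sym (π-combine w j)) a)
                            (Reach-lift (subst (λ v → adj G v w′ ≡ true) (sym (π-combine w j)) a′) r z∉ y∉)

    preimage-isolated : ∀ {S} → (∀ u v → u ∉ S → v ∉ S → u ≡ v) →
                        ∀ {x} → x ∉ preimage n S → Isolated (D n G) (preimage n S) x
    preimage-isolated ≤1 {x} x∉ {z} a z∉ with ≤1 (π z) (π x) (∉preimage⁻ z∉) (∉preimage⁻ x∉)
    ... | πz≡πx = true≢false (trans (sym (subst (λ v → adj G (π x) v ≡ true) πz≡πx a)) (irrefl G (π x)))
      where
      true≢false : true ≢ false
      true≢false ()

    IsCut-preimage : 1 ≤ n → ∀ {S} → IsCut G S → IsCut (D n G) (preimage n S)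
    IsCut-preimage n≥1 {S} (inj₂ (u , v , u∉ , v∉ , ¬u⇝v)) =
      inj₂ (combine u j , combine v j , ∉⇒combine∉preimage j u∉ , ∉⇒combine∉preimage j v∉ ,
            λ r → ¬u⇝v (subst₂ (Reach G S) (π-combine u j) (π-combine v j) (Reach-π ∉preimage⁻ r)))
      where
      j : Fin n
      j = Fin.fromℕ< n≥1
    IsCut-preimage n≥1 {S} (inj₁ ≤1) with any? (λ u → ¬? (u ∈? S))
    ... | yes (u , u∉) = isolated⇒IsCut c∉ (preimage-isolated ≤1 c∉)
      where
      c∉ : combine u (Fin.fromℕ< n≥1) ∉ preimage n S
      c∉ = ∉⇒combine∉preimage (Fin.fromℕ< n≥1) u∉
    ... | no ∄u∉ = inj₁ λ x _ x∉ _ → contradiction (π x , ∉preimage⁻ x∉) ∄u∉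

    IsCut-fullFibres : ∀ {T} → IsCut (D n G) T → IsCut G (fullFibres T)
    IsCut-fullFibres {T} (inj₁ ≤1) = inj₁ λ u v u∉ v∉ → sameFibre (∉fullFibres⇒copy∉ u∉) (∉fullFibres⇒copy∉ v∉)
      where
      sameFibre : ∀ {u v} → ∃[ i ] combine u i ∉ T → ∃[ j ] combine v j ∉ T → u ≡ v
      sameFibre {u} {v} (i , x∉) (j , y∉) = begin
        u                 ≡⟨ π-combine u i ⟨
        π (combine u i)   ≡⟨ cong π (≤1 _ _ x∉ y∉) ⟩
        π (combine v j)   ≡⟨ π-combine v j ⟩
        v                 ∎
        where open ≡-Reasoning
    IsCut-fullFibres (inj₂ (x , y , x∉ , y∉ , ¬x⇝y)) with π x ≟ π y
    ... | no πx≢πy = inj₂ (π x , π y , ∉⇒π∉fullFibres x∉ , ∉⇒π∉fullFibres y∉ ,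
            λ r → let (_ , a , r′) = Reach-≢⇒edge πx≢πy r in ¬x⇝y (Reach-lift a r′ x∉ y∉))
    ... | yes πx≡πy = isolated⇒IsCut (∉⇒π∉fullFibres x∉) λ {w} a w∉ →
      ¬x⇝y (Reach-lift a (there w∉ (subst (λ v → adj G w v ≡ true) πx≡πy (trans (Graph.sym G w (π x)) a))
                                   (here (∉⇒π∉fullFibres y∉))) x∉ y∉)

proposition1p6 : (m n : ℕ) (G : Graph m) → 1 ≤ n → (k : ℕ)
    → IsVertexConnectivity G k → IsVertexConnectivity (D n G) (n * k)
proposition1p6 m n G n≥1 k ((S , S-cut , ∣S∣≡k) , k-minimal) =
  (preimage n S , IsCut-preimage n G n≥1 S-cut , trans (∣preimage∣≡n*∣p∣ n S) (cong (n *_) ∣S∣≡k)) ,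
  n*k-minimal
  where
  open ≤-Reasoning
  n*k-minimal : ∀ T → IsCut (D n G) T → n * k ≤ ∣ T ∣
  n*k-minimal T T-cut = begin
    n * k            ≤⟨ *-monoʳ-≤ n (k-minimal F (IsCut-fullFibres n G T-cut)) ⟩
    n * ∣ F ∣        ≡⟨ ∣preimage∣≡n*∣p∣ n F ⟨
    ∣ preimage n F ∣ ≤⟨ p⊆q⇒∣p∣≤∣q∣ (preimage-fullFibres⊆ {m} n T) ⟩
    ∣ T ∣            ∎
    where
    F : Subset m
    F = fullFibres {m} n T
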